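{- Let $n\geq 2$ be an integer such that $2n+1$ and $2n+3$ are both prime. Then the set of edges $E_3\cup E_{2n+1}\cup E_{2n+3}$ of the prime sum graph $G_{2n}$ contains a Hamilton cycle of $G_{2n}$. In particular, $G_{2n}$ has a Hamilton cycle.
   Context: For a positive integer $m$, the prime sum graph $G_m$ is the graph with vertex set $\{1,2,\dots,m\}$ in which two distinct vertices $i,j$ are adjacent if and only if $i+j$ is a prime number. For a positive integer $s$, $E_s$ denotes the set of edges $uv$ of $G_{2n}$ with $u+v=s$. A Hamilton cycle is a cycle visiting every vertex exactly once. -}

module Defs where

open import Data.Nat using (ℕ; _+_; _*_; _≤_)
open import Data.Nat.Primality using (Prime)
open import Data.List using (List; []; _∷_; _++_; [_]; length)
open import Data.List.Relation.Unary.All using (All)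
open import Data.List.Relation.Unary.Unique.Propositional using (Unique)
open import Data.List.Relation.Unary.Linked using (Linked)
open import Data.Product using (_×_; Σ)
open import Data.Sum using (_⊎_)
open import Data.Empty using (⊥)
open import Data.Unit using (⊤)
open import Relation.Binary.PropositionalEquality using (_≡_; _≢_)
open import Relation.Nullary using (¬_)

IsVertex : ℕ → ℕ → Set
IsVertex m v = 1 ≤ v × v ≤ m

Adjacent : ℕ → ℕ → ℕ → Set
Adjacent m i j = IsVertex m i × IsVertex m j × i ≢ j × Prime (i + j)

CyclicLinked : (ℕ → ℕ → Set) → List ℕ → Set
CyclicLinked R []       = ⊥
CyclicLinked R (x ∷ xs) = Linked R ((x ∷ xs) ++ [ x ])

HamiltonCycleWithin : ℕ → (ℕ → ℕ → Set) → Set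
HamiltonCycleWithin m P =
  Σ (List ℕ) λ vs →
    3 ≤ m × length vs ≡ m × Unique vs × All (IsVertex m) vs
    × CyclicLinked (λ u v → Adjacent m u v × P u v) vs

HamiltonCycle : ℕ → Set
HamiltonCycle m = HamiltonCycleWithin m (λ _ _ → ⊤)

InE : ℕ → ℕ → ℕ → Set
InE s u v = u + v ≡ s

-- Arrange the odd vertices increasingly and the even ones decreasingly, interleaved:
-- 1, 2n, 3, 2n − 2, 5, …, 2n − 1, 2.  Consecutive sums alternate between 2n + 1 and
-- 2n + 3, and the closing edge 2 → 1 has sum 3.  All these sums are odd primes, and
-- an odd sum forces its two summands to be distinct, so every step is an edge of G_2n.
module Submission where

open import Defs
open import Data.Nat using (ℕ; zero; suc; pred; _+_; _*_; _≤_; _<_; s≤s; z≤n)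
open import Data.Nat.Primality using (Prime; prime?)
open import Data.Nat.Properties
  using (even≢odd; *-cancelˡ-≡; *-suc; *-monoʳ-≤; +-identityʳ; +-comm; +-suc; m≤m+n; m≤n+m; n≤1+n; <⇒≢; ≤-refl; ≤-trans)
open import Data.Nat.Tactic.RingSolver using (solve-∀)
open import Data.Product using (_×_; _,_; proj₁)
open import Data.Sum using (_⊎_; inj₁; inj₂)
open import Data.List using (List; []; _∷_; _++_; [_]; length)
open import Data.List.Relation.Unary.All using (All; []; _∷_)
open import Data.List.Relation.Unary.All.Properties using (++⁺)
open import Data.List.Relation.Unary.AllPairs using ([]; _∷_)
open import Data.List.Relation.Unary.Unique.Propositional using (Unique)
open import Data.List.Relation.Unary.Linked as Linked using (Linked; []; [-]; _∷_)
open import Data.Unit using (tt)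
open import Relation.Nullary.Decidable using (from-yes)
open import Relation.Binary.PropositionalEquality using (_≡_; _≢_; refl; sym; trans; cong; subst)

linked-within : ∀ {A : Set} {V : A → Set} {P Q : A → A → Set} →
  (∀ {u v} → V u → V v → P u v → Q u v) →
  ∀ {xs} → All V xs → Linked P xs → Linked Q xs
linked-within f _              []       = []
linked-within f _              [-]      = [-]
linked-within f (vu ∷ vv ∷ vs) (p ∷ ps) = f vu vv p ∷ linked-within f (vv ∷ vs) ps

hamiltonCycleWithin⇒hamiltonCycle : ∀ {m P} → HamiltonCycleWithin m P → HamiltonCycle m
hamiltonCycleWithin⇒hamiltonCycle (x ∷ xs , size , len , uniq , verts , cyc) =
  x ∷ xs , size , len , uniq , verts , Linked.map (λ r → proj₁ r , tt) cyc

odd-sum⇒≢ : ∀ {u v k} → u + v ≡ suc (2 * k) → u ≢ v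
odd-sum⇒≢ {u} {k = k} sum refl = even≢odd u k (trans (cong (u +_) (+-identityʳ u)) sum)

odd-prime-sum⇒adjacent : ∀ {m u v k} → IsVertex m u → IsVertex m v →
  u + v ≡ suc (2 * k) → Prime (u + v) → Adjacent m u v
odd-prime-sum⇒adjacent {k = k} iu iv sum p = iu , iv , odd-sum⇒≢ {k = k} sum , p

zigzag : ℕ → ℕ → List ℕ
zigzag j zero    = []
zigzag j (suc k) = suc (2 * j) ∷ 2 * suc k ∷ zigzag (suc j) k

length-zigzag : ∀ j k → length (zigzag j k) ≡ 2 * k
length-zigzag j zero    = refl
length-zigzag j (suc k) = trans (cong (2 +_) (length-zigzag (suc j) k)) (sym (*-suc 2 k))

zigzag-vertices : ∀ {n} j k → j + k ≤ n → All (IsVertex (2 * n)) (zigzag j k)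
zigzag-vertices     j zero    _     = []
zigzag-vertices {n} j (suc k) j+k≤n =
  (s≤s z≤n , ≤-trans (n≤1+n _) (subst (_≤ 2 * n) (*-suc 2 j) (*-monoʳ-≤ 2 j<n))) ∷
  (s≤s z≤n , *-monoʳ-≤ 2 k<n) ∷
  zigzag-vertices (suc j) k (subst (_≤ n) (+-suc j k) j+k≤n)
  where
  j<n : suc j ≤ n
  j<n = ≤-trans (subst (suc j ≤_) (sym (+-suc j k)) (s≤s (m≤m+n j k))) j+k≤n
  k<n : suc k ≤ n
  k<n = ≤-trans (m≤n+m (suc k) j) j+k≤n

zigzag-odd-below : ∀ {i} j k → i < j → All (suc (2 * i) ≢_) (zigzag j k)
zigzag-odd-below j zero    _   = []
zigzag-odd-below {i} j (suc k) i<j =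
  (λ eq → <⇒≢ i<j (*-cancelˡ-≡ i j 2 (cong pred eq))) ∷
  (λ eq → even≢odd (suc k) i (sym eq)) ∷
  zigzag-odd-below (suc j) k (≤-trans i<j (n≤1+n j))

zigzag-even-above : ∀ {i} j k → k < i → All (2 * i ≢_) (zigzag j k)
zigzag-even-above j zero    _   = []
zigzag-even-above {i} j (suc k) k<i =
  (λ eq → even≢odd i j eq) ∷
  (λ eq → <⇒≢ k<i (sym (*-cancelˡ-≡ i (suc k) 2 eq))) ∷
  zigzag-even-above (suc j) k (≤-trans (n≤1+n (suc k)) k<i)

zigzag-unique : ∀ j k → Unique (zigzag j k)
zigzag-unique j zero    = []
zigzag-unique j (suc k) =
  ((λ eq → even≢odd (suc k) j (sym eq)) ∷ zigzag-odd-below (suc j) k ≤-refl) ∷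
  zigzag-even-above (suc j) k ≤-refl ∷
  zigzag-unique (suc j) k

odd+even≡2*[j+suc[k]]+1 : ∀ j k → suc (2 * j) + 2 * suc k ≡ 2 * (j + suc k) + 1
odd+even≡2*[j+suc[k]]+1 = solve-∀

even+odd≡2*[j+suc[suc[k]]]+3 : ∀ j k → 2 * suc (suc k) + suc (2 * suc j) ≡ 2 * (j + suc (suc k)) + 3
even+odd≡2*[j+suc[suc[k]]]+3 = solve-∀

suc[2*suc[n]]≡2*n+3 : ∀ n → suc (2 * suc n) ≡ 2 * n + 3
suc[2*suc[n]]≡2*n+3 = solve-∀

module _ (n : ℕ) where

  SumInE : ℕ → ℕ → Set
  SumInE u v = InE 3 u v ⊎ InE (2 * n + 1) u v ⊎ InE (2 * n + 3) u v

  zigzag-sums : ∀ j k → j + suc k ≡ n → Linked SumInE (zigzag j (suc k) ++ [ 1 ])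
  zigzag-sums j zero    refl = inj₂ (inj₁ (odd+even≡2*[j+suc[k]]+1 j 0)) ∷ inj₁ refl ∷ [-]
  zigzag-sums j (suc k) refl =
    inj₂ (inj₁ (odd+even≡2*[j+suc[k]]+1 j (suc k))) ∷ inj₂ (inj₂ (even+odd≡2*[j+suc[suc[k]]]+3 j k)) ∷
    zigzag-sums (suc j) k (sym (+-suc j (suc k)))

  module _ (prime₁ : Prime (2 * n + 1)) (prime₃ : Prime (2 * n + 3)) where

    sumInE⇒adjacent : ∀ {u v} → IsVertex (2 * n) u → IsVertex (2 * n) v →
      SumInE u v → Adjacent (2 * n) u v × SumInE u v
    sumInE⇒adjacent iu iv s@(inj₁ sum) =
      odd-prime-sum⇒adjacent {k = 1} iu iv sum (subst Prime (sym sum) (from-yes (prime? 3))) , s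
    sumInE⇒adjacent iu iv s@(inj₂ (inj₁ sum)) =
      odd-prime-sum⇒adjacent {k = n} iu iv (trans sum (+-comm (2 * n) 1)) (subst Prime (sym sum) prime₁) , s
    sumInE⇒adjacent iu iv s@(inj₂ (inj₂ sum)) =
      odd-prime-sum⇒adjacent {k = suc n} iu iv (trans sum (sym (suc[2*suc[n]]≡2*n+3 n))) (subst Prime (sym sum) prime₃) , s

zigzag-hamiltonCycle : ∀ n → 2 ≤ n → Prime (2 * n + 1) → Prime (2 * n + 3) →
  HamiltonCycleWithin (2 * n) (SumInE n)
zigzag-hamiltonCycle n@(suc k) 2≤n prime₁ prime₃ =
  zigzag 0 n , 3≤2n , length-zigzag 0 n , zigzag-unique 0 n , vertices ,
  linked-within (sumInE⇒adjacent n prime₁ prime₃)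
    (++⁺ vertices ((s≤s z≤n , ≤-trans (s≤s z≤n) 3≤2n) ∷ [])) (zigzag-sums n 0 k refl)
  where
  3≤2n : 3 ≤ 2 * n
  3≤2n = ≤-trans (n≤1+n 3) (*-monoʳ-≤ 2 2≤n)
  vertices : All (IsVertex (2 * n)) (zigzag 0 n)
  vertices = zigzag-vertices 0 n ≤-refl

corollary1 : (n : ℕ) → 2 ≤ n → Prime (2 * n + 1) → Prime (2 * n + 3) →
    HamiltonCycleWithin (2 * n) (λ u v → InE 3 u v ⊎ InE (2 * n + 1) u v ⊎ InE (2 * n + 3) u v)
    × HamiltonCycle (2 * n)
corollary1 n 2≤n prime₁ prime₃ = cycle , hamiltonCycleWithin⇒hamiltonCycle cycle
  where
  cycle : HamiltonCycleWithin (2 * n) (SumInE n)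
  cycle = zigzag-hamiltonCycle n 2≤n prime₁ prime₃
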